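{- For all integers $n\geq 1$: $\overline{pl}_4(12n)\equiv 0\pmod 8$, $\overline{pl}_4(6n+3)\equiv 0\pmod 8$, $\overline{pl}_8(210n)\equiv 0\pmod 8$, $\overline{pl}_8(210n+3)\equiv 0\pmod 8$, $\overline{pl}_8(210n+9)\equiv 0\pmod 8$, and $\overline{pl}_8(210n+105)\equiv 0\pmod 8$.
   Context: A plane overpartition of $n$ is a plane partition of $n$ (an array $(\pi_{ij})_{i,j\geq1}$ of nonnegative integers, weakly decreasing along rows and down columns, with $\sum\pi_{ij}=n$) in which entries may be overlined subject to: in each row, the last occurrence of an integer may be overlined or not and all other occurrences of that integer in the row are not overlined; in each column, the first occurrence of an integer may be overlined or not and all other occurrences of that integer in the column are overlined. A $k$-rowed plane overpartition is a plane overpartition with at most $k$ (nonzero) rows; $\overline{pl}_k(n)$ is their number ($\overline{pl}_k(0)=1$), with generating function $\sum_{n\geq0}\overline{pl}_k(n)q^n=\prod_{n\geq1}\left(\frac{1+q^n}{1-q^n}\right)^{\min\{k,n\}}$. -}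

module Defs where

open import Data.Nat using (ℕ; zero; suc; _+_; _*_; _∸_; _⊓_; _%_; _≡ᵇ_)
open import Data.Bool using (if_then_else_)
open import Data.List using (map; upTo)
open import Data.Nat.ListAction using (sum)

Series : Set
Series = ℕ → ℕ

one : Series
one zero    = 1
one (suc _) = 0

conv : Series → Series → Series
conv f g n = sum (map (λ i → f i * g (n ∸ i)) (upTo (suc n)))

pow : Series → ℕ → Series
pow f zero    = one
pow f (suc e) = conv f (pow f e)

-- the series (1 + q^m)/(1 - q^m) = 1 + 2 Σ_{j≥1} q^{m j}, for m = suc m'
factor : ℕ → Series
factor m' zero    = 1
factor m' (suc i) = if (suc i % suc m') ≡ᵇ 0 then 2 else 0

-- ∏_{m=1}^{N} ((1+q^m)/(1-q^m))^{min(k,m)}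
partialProd : ℕ → ℕ → Series
partialProd k zero    = one
partialProd k (suc N) = conv (pow (factor N) (k ⊓ suc N)) (partialProd k N)

-- plbar k n = coefficient of q^n in ∏_{m≥1} ((1+q^m)/(1-q^m))^{min(k,m)}.
-- Factors with m > n contribute only 1 + O(q^{n+1}), so the product up to m = n suffices.
plbar : ℕ → ℕ → ℕ
plbar k n = partialProd k n n

module Submission where

-- Modulo 8 every factor (1 + q^m)/(1 − q^m) = 1 + 2q^m/(1 − q^m) has fourth power 1, so for
-- k = 4, 8 the coefficient p̄l_k(n), n ≥ k − 1, is that of the finite product
-- G_k = ∏_{m<k} ((1 + q^m)/(1 − q^m))^m.  Clearing denominators, (1 − q^T) G_k ≡ Q_k (mod 8)
-- for a polynomial Q_k of degree T, where T = 12 for k = 4 and T = 420 for k = 8; this is an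
-- identity of polynomials, checked by computation.  Hence the coefficients of G_k are periodic
-- modulo 8 with period T from degree 1 on, and each congruence reduces to finitely many
-- coefficients of Q_k.

open import Defs
open import Algebra using (CommutativeSemiring; CommutativeMonoid)
open import Algebra.Structures.Biased using (isCommutativeSemiringˡ; isCommutativeMonoidˡ)
open import Data.Bool using (true; false; if_then_else_)
open import Data.Fin using (Fin; toℕ; fromℕ<)
import Data.Fin as Fin
open import Data.Fin.Properties using (toℕ-fromℕ<)
open import Data.List using (List; []; _∷_; map; length; drop)
open import Data.List.Properties using (map-applyUpTo; ≡-dec)
open import Data.Nat
  using (ℕ; zero; suc; _+_; _*_; _∸_; _%_; _⊓_; _≡ᵇ_; pred; NonZero; >-nonZero⁻¹;
         _≤_; _<_; _≥_; z≤n; s≤s; z<s; _≤′_; ≤′-refl; ≤′-step)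
open import Data.Nat.Divisibility using (_∣_; m%n≡0⇒n∣m)
open import Data.Nat.DivMod using (%-distribˡ-+; %-distribˡ-*; m%n%n≡m%n; m*n%n≡0; m<n⇒m%n≡m; [m+n]%n≡m%n)
open import Data.Nat.Induction using (<-rec)
open import Data.Nat.ListAction using (sum)
import Data.Nat.Properties as ℕ
open import Data.Nat.Tactic.RingSolver using (solve-∀)
open import Data.Product using (_×_; _,_)
open import Data.Sum using (inj₁; inj₂)
open import Data.Unit using (tt)
open import Function using (id; _∘_)
open import Level using (0ℓ)
open import Relation.Binary.PropositionalEquality
  using (_≡_; refl; sym; trans; cong; cong₂; subst; _≗_; module ≡-Reasoning)
open import Relation.Binary.Structures using (IsEquivalence)
open import Relation.Nullary.Decidable using (toWitness)
open import Algebra.Properties.CommutativeSemigroup ℕ.+-commutativeSemigroup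
  using () renaming (interchange to +-interchange; x∙yz≈y∙xz to x+[y+z]≡y+[x+z])

infixl 6 _+ₛ_
infixl 7 _*ₛ_
infixr 8 _·ₛ_

0ₛ : Series
0ₛ _ = 0

_+ₛ_ : Series → Series → Series
(f +ₛ g) n = f n + g n

_·ₛ_ : ℕ → Series → Series
(c ·ₛ f) n = c * f n

tail : Series → Series
tail f n = f (suc n)

_*ₛ_ : Series → Series → Series
(f *ₛ g) zero    = f 0 * g 0
(f *ₛ g) (suc n) = f 0 * g (suc n) + (tail f *ₛ g) n

*ₛ-zeroˡ : ∀ g → 0ₛ *ₛ g ≗ 0ₛ
*ₛ-zeroˡ g zero    = refl
*ₛ-zeroˡ g (suc n) = *ₛ-zeroˡ g n

*ₛ-identityˡ : ∀ g → one *ₛ g ≗ g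
*ₛ-identityˡ g zero    = ℕ.*-identityˡ (g 0)
*ₛ-identityˡ g (suc n) =
  trans (cong₂ _+_ (ℕ.*-identityˡ (g (suc n))) (*ₛ-zeroˡ g n)) (ℕ.+-identityʳ (g (suc n)))

*ₛ-distribʳ : ∀ f g h → (f +ₛ g) *ₛ h ≗ f *ₛ h +ₛ g *ₛ h
*ₛ-distribʳ f g h zero    = ℕ.*-distribʳ-+ (h 0) (f 0) (g 0)
*ₛ-distribʳ f g h (suc n) = begin
  (f 0 + g 0) * h (suc n) + ((tail f +ₛ tail g) *ₛ h) n
    ≡⟨ cong₂ _+_ (ℕ.*-distribʳ-+ (h (suc n)) (f 0) (g 0)) (*ₛ-distribʳ (tail f) (tail g) h n) ⟩
  (f 0 * h (suc n) + g 0 * h (suc n)) + ((tail f *ₛ h) n + (tail g *ₛ h) n)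
    ≡⟨ +-interchange (f 0 * h (suc n)) (g 0 * h (suc n)) ((tail f *ₛ h) n) ((tail g *ₛ h) n) ⟩
  (f *ₛ h) (suc n) + (g *ₛ h) (suc n) ∎
  where open ≡-Reasoning

*ₛ-scaleˡ : ∀ c f g → (c ·ₛ f) *ₛ g ≗ c ·ₛ (f *ₛ g)
*ₛ-scaleˡ c f g zero    = ℕ.*-assoc c (f 0) (g 0)
*ₛ-scaleˡ c f g (suc n) = begin
  c * f 0 * g (suc n) + ((c ·ₛ tail f) *ₛ g) n
    ≡⟨ cong₂ _+_ (ℕ.*-assoc c (f 0) (g (suc n))) (*ₛ-scaleˡ c (tail f) g n) ⟩
  c * (f 0 * g (suc n)) + c * (tail f *ₛ g) n
    ≡⟨ ℕ.*-distribˡ-+ c _ _ ⟨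
  c * (f *ₛ g) (suc n) ∎
  where open ≡-Reasoning

*ₛ-comm : ∀ f g → f *ₛ g ≗ g *ₛ f
*ₛ-comm f g zero          = ℕ.*-comm (f 0) (g 0)
*ₛ-comm f g (suc zero)    = begin
  f 0 * g 1 + f 1 * g 0 ≡⟨ ℕ.+-comm (f 0 * g 1) (f 1 * g 0) ⟩
  f 1 * g 0 + f 0 * g 1 ≡⟨ cong₂ _+_ (ℕ.*-comm (f 1) (g 0)) (ℕ.*-comm (f 0) (g 1)) ⟩
  g 0 * f 1 + g 1 * f 0 ∎
  where open ≡-Reasoning
*ₛ-comm f g (suc (suc n)) = begin
  f 0 * g (2 + n) + (tail f *ₛ g) (suc n)
    ≡⟨ cong (f 0 * g (2 + n) +_) (*ₛ-comm (tail f) g (suc n)) ⟩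
  f 0 * g (2 + n) + (g 0 * f (2 + n) + (tail g *ₛ tail f) n)
    ≡⟨ cong (λ x → f 0 * g (2 + n) + (g 0 * f (2 + n) + x)) (*ₛ-comm (tail g) (tail f) n) ⟩
  f 0 * g (2 + n) + (g 0 * f (2 + n) + (tail f *ₛ tail g) n)
    ≡⟨ x+[y+z]≡y+[x+z] (f 0 * g (2 + n)) (g 0 * f (2 + n)) ((tail f *ₛ tail g) n) ⟩
  g 0 * f (2 + n) + (f 0 * g (2 + n) + (tail f *ₛ tail g) n)
    ≡⟨ cong (g 0 * f (2 + n) +_) (*ₛ-comm f (tail g) (suc n)) ⟩
  g 0 * f (2 + n) + (tail g *ₛ f) (suc n) ∎
  where open ≡-Reasoning

*ₛ-assoc : ∀ f g h → (f *ₛ g) *ₛ h ≗ f *ₛ (g *ₛ h)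
*ₛ-assoc f g h zero    = ℕ.*-assoc (f 0) (g 0) (h 0)
*ₛ-assoc f g h (suc n) = begin
  f 0 * g 0 * h (suc n) + ((f 0 ·ₛ tail g +ₛ tail f *ₛ g) *ₛ h) n
    ≡⟨ cong (f 0 * g 0 * h (suc n) +_) (*ₛ-distribʳ (f 0 ·ₛ tail g) (tail f *ₛ g) h n) ⟩
  f 0 * g 0 * h (suc n) + (((f 0 ·ₛ tail g) *ₛ h) n + ((tail f *ₛ g) *ₛ h) n)
    ≡⟨ cong₂ (λ x y → f 0 * g 0 * h (suc n) + (x + y))
             (*ₛ-scaleˡ (f 0) (tail g) h n) (*ₛ-assoc (tail f) g h n) ⟩
  f 0 * g 0 * h (suc n) + (f 0 * (tail g *ₛ h) n + (tail f *ₛ (g *ₛ h)) n)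
    ≡⟨ ℕ.+-assoc (f 0 * g 0 * h (suc n)) _ _ ⟨
  f 0 * g 0 * h (suc n) + f 0 * (tail g *ₛ h) n + (tail f *ₛ (g *ₛ h)) n
    ≡⟨ cong (λ x → x + f 0 * (tail g *ₛ h) n + (tail f *ₛ (g *ₛ h)) n) (ℕ.*-assoc (f 0) (g 0) (h (suc n))) ⟩
  f 0 * (g 0 * h (suc n)) + f 0 * (tail g *ₛ h) n + (tail f *ₛ (g *ₛ h)) n
    ≡⟨ cong (_+ (tail f *ₛ (g *ₛ h)) n) (ℕ.*-distribˡ-+ (f 0) _ _) ⟨
  f 0 * (g *ₛ h) (suc n) + (tail f *ₛ (g *ₛ h)) n ∎
  where open ≡-Reasoning

*ₛ-identityʳ : ∀ f → f *ₛ one ≗ f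
*ₛ-identityʳ f n = trans (*ₛ-comm f one n) (*ₛ-identityˡ f n)

conv≗*ₛ : ∀ f g → conv f g ≗ f *ₛ g
conv≗*ₛ f g zero    = ℕ.+-identityʳ (f 0 * g 0)
conv≗*ₛ f g (suc n) = begin
  conv f g (suc n)
    ≡⟨ cong (λ xs → f 0 * g (suc n) + sum xs) (trans
         (map-applyUpTo suc (λ i → f i * g (suc n ∸ i)) (suc n))
         (sym (map-applyUpTo id (λ i → f (suc i) * g (n ∸ i)) (suc n)))) ⟩
  f 0 * g (suc n) + conv (tail f) g n
    ≡⟨ cong (f 0 * g (suc n) +_) (conv≗*ₛ (tail f) g n) ⟩
  (f *ₛ g) (suc n) ∎
  where open ≡-Reasoning

module BigProduct {a} {A : Set a} (_∙_ : A → A → A) (ε : A) where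

  ∏< : (ℕ → A) → ℕ → A
  ∏< F zero    = ε
  ∏< F (suc N) = F N ∙ ∏< F N

module BigProductProperties {c ℓ} (M : CommutativeMonoid c ℓ) where

  open CommutativeMonoid M
    using (_≈_; _∙_; ε; ∙-cong; ∙-congˡ; identityˡ; setoid; commutativeSemigroup)
    renaming (refl to ≈-refl; sym to ≈-sym)
  open BigProduct _∙_ ε public
  open import Algebra.Properties.CommutativeSemigroup commutativeSemigroup using (interchange)
  open import Relation.Binary.Reasoning.Setoid setoid

  ∏<-cong : ∀ {F H} N → (∀ m → F m ≈ H m) → ∏< F N ≈ ∏< H N
  ∏<-cong zero    F≈H = ≈-refl
  ∏<-cong (suc N) F≈H = ∙-cong (F≈H N) (∏<-cong N F≈H)

  ∏<-distrib : ∀ F H N → ∏< (λ m → F m ∙ H m) N ≈ ∏< F N ∙ ∏< H N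
  ∏<-distrib F H zero    = ≈-sym (identityˡ ε)
  ∏<-distrib F H (suc N) = begin
    (F N ∙ H N) ∙ ∏< (λ m → F m ∙ H m) N ≈⟨ ∙-congˡ (∏<-distrib F H N) ⟩
    (F N ∙ H N) ∙ (∏< F N ∙ ∏< H N)      ≈⟨ interchange (F N) (H N) (∏< F N) (∏< H N) ⟩
    (F N ∙ ∏< F N) ∙ (H N ∙ ∏< H N)      ∎

  ∏<-stable : ∀ {F N M} → (∀ m → N ≤ m → F m ≈ ε) → N ≤ M → ∏< F M ≈ ∏< F N
  ∏<-stable {F} {N} F≈ε N≤M = go (ℕ.≤⇒≤′ N≤M)
    where
    go : ∀ {M} → N ≤′ M → ∏< F M ≈ ∏< F N
    go ≤′-refl            = ≈-refl
    go (≤′-step {M} N≤′M) = begin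
      F M ∙ ∏< F M ≈⟨ ∙-cong (F≈ε M (ℕ.≤′⇒≤ N≤′M)) (go N≤′M) ⟩
      ε ∙ ∏< F N   ≈⟨ identityˡ (∏< F N) ⟩
      ∏< F N       ∎

-- Polynomials as coefficient lists

infixl 6 _+ₚ_
infixl 7 _*ₚ_

poly : List ℕ → Series
poly []       _       = 0
poly (x ∷ xs) zero    = x
poly (x ∷ xs) (suc n) = poly xs n

_+ₚ_ : List ℕ → List ℕ → List ℕ
[]       +ₚ ys       = ys
(x ∷ xs) +ₚ []       = x ∷ xs
(x ∷ xs) +ₚ (y ∷ ys) = x + y ∷ xs +ₚ ys

_*ₚ_ : List ℕ → List ℕ → List ℕ
[]       *ₚ ys = []
(x ∷ xs) *ₚ ys = map (x *_) ys +ₚ (0 ∷ xs *ₚ ys)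

poly-+ₚ : ∀ xs ys → poly (xs +ₚ ys) ≗ poly xs +ₛ poly ys
poly-+ₚ []       ys       n       = refl
poly-+ₚ (x ∷ xs) []       n       = sym (ℕ.+-identityʳ (poly (x ∷ xs) n))
poly-+ₚ (x ∷ xs) (y ∷ ys) zero    = refl
poly-+ₚ (x ∷ xs) (y ∷ ys) (suc n) = poly-+ₚ xs ys n

poly-map-* : ∀ c ys → poly (map (c *_) ys) ≗ c ·ₛ poly ys
poly-map-* c []       n       = sym (ℕ.*-zeroʳ c)
poly-map-* c (y ∷ ys) zero    = refl
poly-map-* c (y ∷ ys) (suc n) = poly-map-* c ys n

poly-*ₚ : ∀ xs ys → poly (xs *ₚ ys) ≗ poly xs *ₛ poly ys
poly-*ₚ []       ys n       = sym (*ₛ-zeroˡ (poly ys) n)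
poly-*ₚ (x ∷ xs) ys zero    = begin
  poly (map (x *_) ys +ₚ (0 ∷ xs *ₚ ys)) 0 ≡⟨ poly-+ₚ (map (x *_) ys) (0 ∷ xs *ₚ ys) 0 ⟩
  poly (map (x *_) ys) 0 + 0               ≡⟨ ℕ.+-identityʳ _ ⟩
  poly (map (x *_) ys) 0                   ≡⟨ poly-map-* x ys 0 ⟩
  x * poly ys 0                            ∎
  where open ≡-Reasoning
poly-*ₚ (x ∷ xs) ys (suc n) = begin
  poly (map (x *_) ys +ₚ (0 ∷ xs *ₚ ys)) (suc n) ≡⟨ poly-+ₚ (map (x *_) ys) (0 ∷ xs *ₚ ys) (suc n) ⟩
  poly (map (x *_) ys) (suc n) + poly (xs *ₚ ys) n
    ≡⟨ cong₂ _+_ (poly-map-* x ys (suc n)) (poly-*ₚ xs ys n) ⟩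
  x * poly ys (suc n) + (poly xs *ₛ poly ys) n  ∎
  where open ≡-Reasoning

_^ₚ_ : List ℕ → ℕ → List ℕ
xs ^ₚ zero  = 1 ∷ []
xs ^ₚ suc e = xs *ₚ xs ^ₚ e

open BigProduct _*ₚ_ (1 ∷ []) using () renaming (∏< to ∏ₚ<)

poly-beyond : ∀ xs {n} → length xs ≤ n → poly xs n ≡ 0
poly-beyond []       _         = refl
poly-beyond (x ∷ xs) (s≤s len) = poly-beyond xs len

constant-^ₚ : ∀ xs e → poly xs 0 ≡ 1 → poly (xs ^ₚ e) 0 ≡ 1
constant-^ₚ xs zero    _    = refl
constant-^ₚ xs (suc e) xs₀≡1 =
  trans (poly-*ₚ xs (xs ^ₚ e) 0) (cong₂ _*_ xs₀≡1 (constant-^ₚ xs e xs₀≡1))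

constant-∏ₚ< : ∀ {F} N → (∀ m → poly (F m) 0 ≡ 1) → poly (∏ₚ< F N) 0 ≡ 1
constant-∏ₚ< {F} zero    _  = refl
constant-∏ₚ< {F} (suc N) F₀≡1 =
  trans (poly-*ₚ (F N) (∏ₚ< F N) 0) (cong₂ _*_ (F₀≡1 N) (constant-∏ₚ< N F₀≡1))

monomialₚ : ℕ → ℕ → List ℕ
monomialₚ c zero    = c ∷ []
monomialₚ c (suc s) = 0 ∷ monomialₚ c s

-- 1 + c·q^(1+s)
binomialₚ : ℕ → ℕ → List ℕ
binomialₚ c s = 1 ∷ monomialₚ c s

monomialₚ-*ₛ-low : ∀ c g {s i} → i < s → (poly (monomialₚ c s) *ₛ g) i ≡ 0
monomialₚ-*ₛ-low c g {suc s} {zero}  _         = refl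
monomialₚ-*ₛ-low c g {suc s} {suc i} (s≤s i<s) = monomialₚ-*ₛ-low c g i<s

monomialₚ-*ₛ-high : ∀ c g s n → (poly (monomialₚ c s) *ₛ g) (s + n) ≡ c * g n
monomialₚ-*ₛ-high c g zero    zero    = refl
monomialₚ-*ₛ-high c g zero    (suc n) = trans (cong (c * g (suc n) +_) (*ₛ-zeroˡ g n)) (ℕ.+-identityʳ _)
monomialₚ-*ₛ-high c g (suc s) n       = monomialₚ-*ₛ-high c g s n

binomialₚ-*ₛ-low : ∀ c g {s n} → n ≤ s → (poly (binomialₚ c s) *ₛ g) n ≡ g n
binomialₚ-*ₛ-low c g {n = zero}  _   = ℕ.*-identityˡ (g 0)
binomialₚ-*ₛ-low c g {n = suc n} n<s =
  trans (cong₂ _+_ (ℕ.*-identityˡ (g (suc n))) (monomialₚ-*ₛ-low c g n<s)) (ℕ.+-identityʳ (g (suc n)))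

binomialₚ-*ₛ-high : ∀ c g s n → (poly (binomialₚ c s) *ₛ g) (suc s + n) ≡ g (suc s + n) + c * g n
binomialₚ-*ₛ-high c g s n = cong₂ _+_ (ℕ.*-identityˡ (g (suc s + n))) (monomialₚ-*ₛ-high c g s n)

1+q^[1+_] : ℕ → List ℕ
1+q^[1+ s ] = binomialₚ 1 s

factor-low : ∀ m {n} → n < m → factor m (suc n) ≡ 0
factor-low m n<m = cong (λ r → if r ≡ᵇ 0 then 2 else 0) (m<n⇒m%n≡m (s≤s n<m))

factor-shift : ∀ m n → factor m (suc m + n) ≡ (if n % suc m ≡ᵇ 0 then 2 else 0)
factor-shift m n = cong (λ r → if r ≡ᵇ 0 then 2 else 0)
  (trans (cong (_% suc m) (ℕ.+-comm (suc m) n)) ([m+n]%n≡m%n n (suc m)))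

-- Series modulo d

module Modulo (d : ℕ) .{{_ : NonZero d}} where

  infix 4 _≋_ _≈_

  _≋_ : ℕ → ℕ → Set
  a ≋ b = a % d ≡ b % d

  +-cong-≋ : ∀ {a a′ b b′} → a ≋ a′ → b ≋ b′ → a + b ≋ a′ + b′
  +-cong-≋ {a} {a′} {b} {b′} a≋a′ b≋b′ = begin
    (a + b) % d             ≡⟨ %-distribˡ-+ a b d ⟩
    (a % d + b % d) % d     ≡⟨ cong₂ (λ x y → (x + y) % d) a≋a′ b≋b′ ⟩
    (a′ % d + b′ % d) % d   ≡⟨ %-distribˡ-+ a′ b′ d ⟨
    (a′ + b′) % d           ∎
    where open ≡-Reasoning

  *-cong-≋ : ∀ {a a′ b b′} → a ≋ a′ → b ≋ b′ → a * b ≋ a′ * b′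
  *-cong-≋ {a} {a′} {b} {b′} a≋a′ b≋b′ = begin
    (a * b) % d             ≡⟨ %-distribˡ-* a b d ⟩
    (a % d * (b % d)) % d   ≡⟨ cong₂ (λ x y → (x * y) % d) a≋a′ b≋b′ ⟩
    (a′ % d * (b′ % d)) % d ≡⟨ %-distribˡ-* a′ b′ d ⟨
    (a′ * b′) % d           ∎
    where open ≡-Reasoning

  x+[d-1]x≋0 : ∀ x → x + pred d * x ≋ 0
  x+[d-1]x≋0 x = begin
    (x + pred d * x) % d ≡⟨ cong (λ n → (n * x) % d) (ℕ.suc-pred d) ⟩
    (d * x) % d          ≡⟨ cong (_% d) (ℕ.*-comm d x) ⟩
    (x * d) % d          ≡⟨ m*n%n≡0 x d ⟩
    0                    ≡⟨ m*n%n≡0 0 d ⟨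
    0 % d                ∎
    where open ≡-Reasoning

  x+[y+[d-1]y]≋x : ∀ x y → x + (y + pred d * y) ≋ x
  x+[y+[d-1]y]≋x x y = trans (+-cong-≋ {x} refl (x+[d-1]x≋0 y)) (cong (_% d) (ℕ.+-identityʳ x))

  +-cancelʳ-≋ : ∀ {a b c c′} → c ≋ c′ → a + c ≋ b + c′ → a ≋ b
  +-cancelʳ-≋ {a} {b} {c} {c′} c≋c′ a+c≋b+c′ = begin
    a % d                       ≡⟨ x+[y+[d-1]y]≋x a c ⟨
    (a + (c + pred d * c)) % d  ≡⟨ cong (_% d) (ℕ.+-assoc a c _) ⟨
    (a + c + pred d * c) % d    ≡⟨ +-cong-≋ a+c≋b+c′ refl ⟩
    (b + c′ + pred d * c) % d   ≡⟨ +-cong-≋ (+-cong-≋ {b} refl (sym c≋c′)) refl ⟩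
    (b + c + pred d * c) % d    ≡⟨ cong (_% d) (ℕ.+-assoc b c _) ⟩
    (b + (c + pred d * c)) % d  ≡⟨ x+[y+[d-1]y]≋x b c ⟩
    b % d                       ∎
    where open ≡-Reasoning

  -- A record rather than a bare ∀, so that unification can invert it.
  record _≈_ (f g : Series) : Set where
    constructor coeffwise
    field coeff : ∀ n → f n ≋ g n
  open _≈_ public

  ≗⇒≈ : ∀ {f g} → f ≗ g → f ≈ g
  ≗⇒≈ f≗g = coeffwise λ n → cong (_% d) (f≗g n)

  *ₛ-cong-upTo : ∀ {f f′ g g′} n → (∀ {i} → i ≤ n → f i ≋ f′ i) → (∀ {i} → i ≤ n → g i ≋ g′ i) →
                 (f *ₛ g) n ≋ (f′ *ₛ g′) n
  *ₛ-cong-upTo zero    f≋f′ g≋g′ = *-cong-≋ (f≋f′ z≤n) (g≋g′ z≤n)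
  *ₛ-cong-upTo (suc n) f≋f′ g≋g′ =
    +-cong-≋ (*-cong-≋ (f≋f′ z≤n) (g≋g′ ℕ.≤-refl))
             (*ₛ-cong-upTo n (λ i≤n → f≋f′ (s≤s i≤n)) (λ i≤n → g≋g′ (ℕ.m≤n⇒m≤1+n i≤n)))

  ≈-isEquivalence : IsEquivalence _≈_
  ≈-isEquivalence = record
    { refl  = coeffwise λ _ → refl
    ; sym   = λ f≈g → coeffwise λ n → sym (coeff f≈g n)
    ; trans = λ f≈g g≈h → coeffwise λ n → trans (coeff f≈g n) (coeff g≈h n)
    }

  +-*-commutativeSemiring : CommutativeSemiring 0ℓ 0ℓ
  +-*-commutativeSemiring = record
    { isCommutativeSemiring = isCommutativeSemiringˡ record
      { +-isCommutativeMonoid = isCommutativeMonoidˡ record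
        { isSemigroup = record
          { isMagma = record
            { isEquivalence = ≈-isEquivalence
            ; ∙-cong        = λ f≈f′ g≈g′ → coeffwise λ n → +-cong-≋ (coeff f≈f′ n) (coeff g≈g′ n)
            }
          ; assoc = λ f g h → ≗⇒≈ λ n → ℕ.+-assoc (f n) (g n) (h n)
          }
        ; identityˡ = λ _ → coeffwise λ _ → refl
        ; comm      = λ f g → ≗⇒≈ λ n → ℕ.+-comm (f n) (g n)
        }
      ; *-isCommutativeMonoid = isCommutativeMonoidˡ record
        { isSemigroup = record
          { isMagma = record
            { isEquivalence = ≈-isEquivalence
            ; ∙-cong        = λ f≈f′ g≈g′ → coeffwise λ n →
                                *ₛ-cong-upTo n (λ _ → coeff f≈f′ _) (λ _ → coeff g≈g′ _)
            }
          ; assoc = λ f g h → ≗⇒≈ (*ₛ-assoc f g h)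
          }
        ; identityˡ = λ g → ≗⇒≈ (*ₛ-identityˡ g)
        ; comm      = λ f g → ≗⇒≈ (*ₛ-comm f g)
        }
      ; distribʳ = λ h f g → ≗⇒≈ (*ₛ-distribʳ f g h)
      ; zeroˡ    = λ g → ≗⇒≈ (*ₛ-zeroˡ g)
      }
    }

  open CommutativeSemiring +-*-commutativeSemiring public
    using (rawSemiring; semiring; *-commutativeMonoid; *-commutativeSemigroup; setoid;
           *-cong; *-congˡ; *-congʳ; *-identityˡ; +-congˡ; +-identityʳ; zeroˡ)
    renaming (refl to ≈-refl; sym to ≈-sym; trans to ≈-trans)
  open import Algebra.Definitions.RawSemiring rawSemiring public using (_^_)
  open import Algebra.Properties.CommutativeSemiring.Exp +-*-commutativeSemiring public using (^-distrib-*)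
  open import Algebra.Properties.Semiring.Exp semiring public using (^-congˡ; ^-homo-*)
  open BigProductProperties *-commutativeMonoid public
  open import Algebra.Properties.CommutativeSemigroup *-commutativeSemigroup using (x∙yz≈y∙zx)

  -- 1 − q^(1+s), with −1 represented by d − 1.
  1-q^[1+_] : ℕ → List ℕ
  1-q^[1+ s ] = binomialₚ (pred d) s

  ≈-split : ∀ s {f g} → (∀ {n} → n ≤ s → f n ≋ g n) → (∀ t → f (suc s + t) ≋ g (suc s + t)) → f ≈ g
  ≈-split s low high = coeffwise (split s low high)
    where
    split : ∀ s {f g : Series} → (∀ {n} → n ≤ s → f n ≋ g n) → (∀ t → f (suc s + t) ≋ g (suc s + t)) →
            ∀ n → f n ≋ g n
    split zero    low high zero    = low z≤n
    split zero    low high (suc t) = high t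
    split (suc s) low high zero    = low z≤n
    split (suc s) low high (suc n) = split s (λ n≤s → low (s≤s n≤s)) high n

  *ₛ-cancelˡ : ∀ {D f g} → D 0 ≡ 1 → D *ₛ f ≈ D *ₛ g → f ≈ g
  *ₛ-cancelˡ {D} {f} {g} D₀≡1 Df≈Dg = coeffwise (<-rec (λ n → f n ≋ g n) step)
    where
    D₀* : ∀ x → D 0 * x ≡ x
    D₀* x = trans (cong (_* x) D₀≡1) (ℕ.*-identityˡ x)

    step : ∀ n → (∀ {i} → i < n → f i ≋ g i) → f n ≋ g n
    step zero    _  =
      trans (cong (_% d) (sym (D₀* (f 0)))) (trans (coeff Df≈Dg 0) (cong (_% d) (D₀* (g 0))))
    step (suc n) ih = +-cancelʳ-≋ (*ₛ-cong-upTo n (λ _ → refl) (λ i≤n → ih (s≤s i≤n)))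
      (trans (cong (λ x → (x + (tail D *ₛ f) n) % d) (sym (D₀* (f (suc n)))))
      (trans (coeff Df≈Dg (suc n))
             (cong (λ x → (x + (tail D *ₛ g) n) % d) (D₀* (g (suc n))))))

  cross-multiplication : ∀ {B D G P Q} → D 0 ≡ 1 → G *ₛ D ≈ P → B *ₛ P ≈ D *ₛ Q → B *ₛ G ≈ Q
  cross-multiplication {B} {D} {G} {P} {Q} D₀≡1 GD≈P BP≈DQ = *ₛ-cancelˡ D₀≡1 (begin
    D *ₛ (B *ₛ G) ≈⟨ x∙yz≈y∙zx D B G ⟩
    B *ₛ (G *ₛ D) ≈⟨ *-congˡ GD≈P ⟩
    B *ₛ P        ≈⟨ BP≈DQ ⟩
    D *ₛ Q        ∎)
    where open import Relation.Binary.Reasoning.Setoid setoid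

  poly-[1] : poly (1 ∷ []) ≈ one
  poly-[1] = coeffwise λ { zero → refl ; (suc n) → refl }

  poly-^ₚ : ∀ xs e → poly (xs ^ₚ e) ≈ poly xs ^ e
  poly-^ₚ xs zero    = poly-[1]
  poly-^ₚ xs (suc e) = ≈-trans (≗⇒≈ (poly-*ₚ xs (xs ^ₚ e))) (*-congˡ (poly-^ₚ xs e))

  poly-∏ₚ< : ∀ F N → poly (∏ₚ< F N) ≈ ∏< (λ m → poly (F m)) N
  poly-∏ₚ< F zero    = poly-[1]
  poly-∏ₚ< F (suc N) = ≈-trans (≗⇒≈ (poly-*ₚ (F N) (∏ₚ< F N))) (*-congˡ (poly-∏ₚ< F N))

  poly-map-% : ∀ xs → poly (map (_% d) xs) ≈ poly xs
  poly-map-% xs = coeffwise (reduce xs)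
    where
    reduce : ∀ xs n → poly (map (_% d) xs) n ≋ poly xs n
    reduce []       n       = refl
    reduce (x ∷ xs) zero    = m%n%n≡m%n x d
    reduce (x ∷ xs) (suc n) = reduce xs n

  poly-cong-% : ∀ {xs ys} → map (_% d) xs ≡ map (_% d) ys → poly xs ≈ poly ys
  poly-cong-% {xs} {ys} eq = ≈-trans (≈-sym (poly-map-% xs))
    (≈-trans (≗⇒≈ (λ n → cong (λ zs → poly zs n) eq)) (poly-map-% ys))

  periodic-vanishing : ∀ {g : ℕ → ℕ} p .{{_ : NonZero p}} → (∀ n → g (p + n) ≋ g n) →
                       (∀ (i : Fin p) → g (toℕ i) ≋ 0) → ∀ n → g n ≋ 0
  periodic-vanishing {g} p shift base = <-rec (λ n → g n ≋ 0) step
    where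
    step : ∀ n → (∀ {m} → m < n → g m ≋ 0) → g n ≋ 0
    step n ih with ℕ.<-≤-connex n p
    ... | inj₁ n<p = subst (λ m → g m ≋ 0) (toℕ-fromℕ< n<p) (base (fromℕ< n<p))
    ... | inj₂ p≤n = begin
      g n % d             ≡⟨ cong (λ m → g m % d) (ℕ.m+[n∸m]≡n p≤n) ⟨
      g (p + (n ∸ p)) % d ≡⟨ shift (n ∸ p) ⟩
      g (n ∸ p) % d       ≡⟨ ih (ℕ.∸-monoʳ-< (>-nonZero⁻¹ p) p≤n) ⟩
      0 % d               ∎
      where open ≡-Reasoning

  module LinearRecurrence (s : ℕ) (G : Series) (Q : List ℕ)
                          (recurrence : poly (1-q^[1+ s ]) *ₛ G ≈ poly Q)
                          (deg : length Q ≤ suc (suc s)) where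

    coeff-low : ∀ {n} → n ≤ s → G n ≋ poly Q n
    coeff-low {n} n≤s = trans (cong (_% d) (sym (binomialₚ-*ₛ-low (pred d) G n≤s))) (coeff recurrence n)

    coeff-step : ∀ n → G (suc s + n) ≋ poly Q (suc s + n) + G n
    coeff-step n = +-cancelʳ-≋ {c = pred d * G n} refl (begin
      (G (suc s + n) + pred d * G n) % d
        ≡⟨ cong (_% d) (binomialₚ-*ₛ-high (pred d) G s n) ⟨
      (poly (1-q^[1+ s ]) *ₛ G) (suc s + n) % d
        ≡⟨ coeff recurrence (suc s + n) ⟩
      poly Q (suc s + n) % d
        ≡⟨ x+[y+[d-1]y]≋x (poly Q (suc s + n)) (G n) ⟨
      (poly Q (suc s + n) + (G n + pred d * G n)) % d
        ≡⟨ cong (_% d) (ℕ.+-assoc (poly Q (suc s + n)) (G n) _) ⟨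
      (poly Q (suc s + n) + G n + pred d * G n) % d ∎)
      where open ≡-Reasoning

    coeff-second : ∀ {n} → n ≤ s → G (suc s + n) ≋ poly Q (suc s + n) + poly Q n
    coeff-second {n} n≤s = trans (coeff-step n) (+-cong-≋ {poly Q (suc s + n)} refl (coeff-low n≤s))

    periodic : ∀ {n} → 0 < n → G (suc s + n) ≋ G n
    periodic {suc n} _ = trans (coeff-step (suc n)) (cong (λ x → (x + G (suc n)) % d) (poly-beyond Q Q≤))
      where
      Q≤ : length Q ≤ suc s + suc n
      Q≤ = ℕ.≤-trans deg (ℕ.≤-trans (s≤s (s≤s (ℕ.m≤m+n s n)))
                                    (ℕ.≤-reflexive (cong suc (sym (ℕ.+-suc s n)))))

    vanishes-along : ∀ a c p .{{_ : NonZero p}} → 0 < a → c * p ≡ suc s →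
                     (∀ (i : Fin p) → G (a + c * toℕ i) ≋ 0) → ∀ n → G (a + c * n) ≋ 0
    vanishes-along a c p 0<a cp≡T = periodic-vanishing p shift
      where
      shift : ∀ n → G (a + c * (p + n)) ≋ G (a + c * n)
      shift n = trans (cong (λ m → G m % d) (begin
          a + c * (p + n)     ≡⟨ cong (a +_) (ℕ.*-distribˡ-+ c p n) ⟩
          a + (c * p + c * n) ≡⟨ cong (λ x → a + (x + c * n)) cp≡T ⟩
          a + (suc s + c * n) ≡⟨ x+[y+z]≡y+[x+z] a (suc s) (c * n) ⟩
          suc s + (a + c * n) ∎))
        (periodic (ℕ.<-≤-trans 0<a (ℕ.m≤m+n a (c * n))))
        where open ≡-Reasoning

    vanishes-along-half-period : ∀ c r → c + c ≡ suc s → c + r ≤ s → poly Q (c + r) ≋ 0 →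
                                 poly Q (c + c + r) + poly Q r ≋ 0 → ∀ n → G (c + r + c * n) ≋ 0
    vanishes-along-half-period (suc c) r c+c≡T c+r≤s Q[c+r]≋0 Q[2c+r]+Q[r]≋0 =
      vanishes-along (suc c + r) (suc c) 2 z<s (trans (c*2≡c+c (suc c)) c+c≡T) λ
        { Fin.zero →
            subst (λ m → G m ≋ 0) (c+r≡c+r+c*0 (suc c) r) (trans (coeff-low c+r≤s) Q[c+r]≋0)
        ; (Fin.suc Fin.zero) →
            subst (λ m → G m ≋ 0) (trans (cong (_+ r) (sym c+c≡T)) (c+c+r≡c+r+c*1 (suc c) r))
              (trans (coeff-second (ℕ.m+n≤o⇒n≤o (suc c) c+r≤s))
                     (subst (λ m → poly Q (m + r) + poly Q r ≋ 0) c+c≡T Q[2c+r]+Q[r]≋0))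
        }
      where
      c*2≡c+c : ∀ c → c * 2 ≡ c + c
      c*2≡c+c = solve-∀
      c+r≡c+r+c*0 : ∀ c r → c + r ≡ c + r + c * 0
      c+r≡c+r+c*0 = solve-∀
      c+c+r≡c+r+c*1 : ∀ c r → c + c + r ≡ c + r + c * 1
      c+c+r≡c+r+c*1 = solve-∀

  factor*[1-q]≈1+q : ∀ m → factor m *ₛ poly (1-q^[1+ m ]) ≈ poly (1+q^[1+ m ])
  factor*[1-q]≈1+q m = ≈-trans (≗⇒≈ (*ₛ-comm (factor m) _)) (≈-split m low high)
    where
    low : ∀ {n} → n ≤ m → (poly (1-q^[1+ m ]) *ₛ factor m) n ≋ poly (1+q^[1+ m ]) n
    low {zero}  _   = refl
    low {suc n} n<m = cong (_% d) (begin
      (poly (1-q^[1+ m ]) *ₛ factor m) (suc n) ≡⟨ binomialₚ-*ₛ-low (pred d) (factor m) n<m ⟩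
      factor m (suc n)                         ≡⟨ factor-low m n<m ⟩
      one (suc n)                              ≡⟨ binomialₚ-*ₛ-low 1 one n<m ⟨
      (poly (1+q^[1+ m ]) *ₛ one) (suc n)      ≡⟨ *ₛ-identityʳ (poly (1+q^[1+ m ])) (suc n) ⟩
      poly (1+q^[1+ m ]) (suc n)               ∎)
      where open ≡-Reasoning

    high-coeff : ∀ t → (if t % suc m ≡ᵇ 0 then 2 else 0) + pred d * factor m t ≋ 1 * one t
    high-coeff zero    = +-cong-≋ {1} refl (x+[d-1]x≋0 1)
    high-coeff (suc t) = x+[d-1]x≋0 (factor m (suc t))

    high : ∀ t → (poly (1-q^[1+ m ]) *ₛ factor m) (suc m + t) ≋ poly (1+q^[1+ m ]) (suc m + t)
    high t = begin
      (poly (1-q^[1+ m ]) *ₛ factor m) (suc m + t) % d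
        ≡⟨ cong (_% d) (binomialₚ-*ₛ-high (pred d) (factor m) m t) ⟩
      (factor m (suc m + t) + pred d * factor m t) % d
        ≡⟨ cong (λ x → (x + pred d * factor m t) % d) (factor-shift m t) ⟩
      ((if t % suc m ≡ᵇ 0 then 2 else 0) + pred d * factor m t) % d
        ≡⟨ high-coeff t ⟩
      (one (suc m + t) + 1 * one t) % d
        ≡⟨ cong (_% d) (binomialₚ-*ₛ-high 1 one m t) ⟨
      (poly (1+q^[1+ m ]) *ₛ one) (suc m + t) % d
        ≡⟨ cong (_% d) (*ₛ-identityʳ (poly (1+q^[1+ m ])) (suc m + t)) ⟩
      poly (1+q^[1+ m ]) (suc m + t) % d ∎
      where open ≡-Reasoning

  pow≈^ : ∀ f e → pow f e ≈ f ^ e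
  pow≈^ f zero    = ≈-refl
  pow≈^ f (suc e) = ≈-trans (≗⇒≈ (conv≗*ₛ f (pow f e))) (*-congˡ (pow≈^ f e))

  partialProd≈∏< : ∀ k N → partialProd k N ≈ ∏< (λ m → factor m ^ (k ⊓ suc m)) N
  partialProd≈∏< k zero    = ≈-refl
  partialProd≈∏< k (suc N) = ≈-trans (≗⇒≈ (conv≗*ₛ (pow (factor N) (k ⊓ suc N)) (partialProd k N)))
                                     (*-cong (pow≈^ (factor N) (k ⊓ suc N)) (partialProd≈∏< k N))

  plbar≋partialProd : ∀ k → (∀ m → factor m ^ suc k ≈ one) →
                      ∀ {n} → k ≤ n → plbar (suc k) n ≋ partialProd (suc k) k n
  plbar≋partialProd k factorᵏ⁺¹≈1 {n} k≤n = begin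
    partialProd (suc k) n n % d                     ≡⟨ coeff (partialProd≈∏< (suc k) n) n ⟩
    ∏< (λ m → factor m ^ (suc k ⊓ suc m)) n n % d   ≡⟨ coeff (∏<-stable stable k≤n) n ⟩
    ∏< (λ m → factor m ^ (suc k ⊓ suc m)) k n % d   ≡⟨ coeff (partialProd≈∏< (suc k) k) n ⟨
    partialProd (suc k) k n % d                     ∎
    where
    open ≡-Reasoning
    stable : ∀ m → k ≤ m → factor m ^ (suc k ⊓ suc m) ≈ one
    stable m k≤m = subst (λ e → factor m ^ e ≈ one) (sym (ℕ.m≤n⇒m⊓n≡m (s≤s k≤m))) (factorᵏ⁺¹≈1 m)

  numeratorₚ denominatorₚ : ℕ → ℕ → List ℕ
  numeratorₚ   k N = ∏ₚ< (λ m → 1+q^[1+ m ] ^ₚ (k ⊓ suc m)) N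
  denominatorₚ k N = ∏ₚ< (λ m → 1-q^[1+ m ] ^ₚ (k ⊓ suc m)) N

  partialProd*denominator≈numerator : ∀ k N →
    partialProd k N *ₛ poly (denominatorₚ k N) ≈ poly (numeratorₚ k N)
  partialProd*denominator≈numerator k N = begin
    partialProd k N *ₛ poly (denominatorₚ k N)
      ≈⟨ *-cong (partialProd≈∏< k N) (poly-∏ₚ< (λ m → 1-q^[1+ m ] ^ₚ e m) N) ⟩
    ∏< (λ m → factor m ^ e m) N *ₛ ∏< (λ m → poly (1-q^[1+ m ] ^ₚ e m)) N
      ≈⟨ ∏<-distrib (λ m → factor m ^ e m) (λ m → poly (1-q^[1+ m ] ^ₚ e m)) N ⟨
    ∏< (λ m → factor m ^ e m *ₛ poly (1-q^[1+ m ] ^ₚ e m)) N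
      ≈⟨ ∏<-cong N factorᵉ*[1-q]ᵉ≈[1+q]ᵉ ⟩
    ∏< (λ m → poly (1+q^[1+ m ] ^ₚ e m)) N
      ≈⟨ poly-∏ₚ< (λ m → 1+q^[1+ m ] ^ₚ e m) N ⟨
    poly (numeratorₚ k N) ∎
    where
    open import Relation.Binary.Reasoning.Setoid setoid
    e : ℕ → ℕ
    e m = k ⊓ suc m
    factorᵉ*[1-q]ᵉ≈[1+q]ᵉ : ∀ m → factor m ^ e m *ₛ poly (1-q^[1+ m ] ^ₚ e m) ≈ poly (1+q^[1+ m ] ^ₚ e m)
    factorᵉ*[1-q]ᵉ≈[1+q]ᵉ m = begin
      factor m ^ e m *ₛ poly (1-q^[1+ m ] ^ₚ e m) ≈⟨ *-congˡ (poly-^ₚ (1-q^[1+ m ]) (e m)) ⟩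
      factor m ^ e m *ₛ poly (1-q^[1+ m ]) ^ e m  ≈⟨ ^-distrib-* (factor m) (poly (1-q^[1+ m ])) (e m) ⟨
      (factor m *ₛ poly (1-q^[1+ m ])) ^ e m      ≈⟨ ^-congˡ (e m) (factor*[1-q]≈1+q m) ⟩
      poly (1+q^[1+ m ]) ^ e m                    ≈⟨ poly-^ₚ (1+q^[1+ m ]) (e m) ⟨
      poly (1+q^[1+ m ] ^ₚ e m)                   ∎

  partialProd-recurrence : ∀ k N s Q →
    map (_% d) (1-q^[1+ s ] *ₚ numeratorₚ k N) ≡ map (_% d) (denominatorₚ k N *ₚ Q) →
    poly (1-q^[1+ s ]) *ₛ partialProd k N ≈ poly Q
  partialProd-recurrence k N s Q check =
    cross-multiplication (constant-∏ₚ< N (λ m → constant-^ₚ (1-q^[1+ m ]) (k ⊓ suc m) refl))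
                         (partialProd*denominator≈numerator k N) (begin
      poly B *ₛ poly (numeratorₚ k N)     ≈⟨ ≗⇒≈ (poly-*ₚ B (numeratorₚ k N)) ⟨
      poly (B *ₚ numeratorₚ k N)          ≈⟨ poly-cong-% check ⟩
      poly (denominatorₚ k N *ₚ Q)        ≈⟨ ≗⇒≈ (poly-*ₚ (denominatorₚ k N) Q) ⟩
      poly (denominatorₚ k N) *ₛ poly Q   ∎)
    where
    open import Relation.Binary.Reasoning.Setoid setoid
    B : List ℕ
    B = 1-q^[1+ s ]

  -- The first L coefficients of N / D modulo d by long division, assuming D has constant term 1.
  quotientₚ : ℕ → List ℕ → List ℕ → List ℕ
  quotientₚ zero    N D = []
  quotientₚ (suc L) N D = c ∷ quotientₚ L (drop 1 (map (_% d) (N +ₚ map (pred d * c *_) D))) D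
    where c = poly N 0 % d

-- The products for k = 4 and k = 8 modulo 8

open Modulo 8
-- `n · x` is the multiple through which the ring solver interprets numerals.
open import Algebra.Properties.Semiring.Mult.TCOptimised semiring using () renaming (_×_ to _·_)
open import Algebra.Solver.Ring.NaturalCoefficients.Default +-*-commutativeSemiring
  using (solve; _:+_; _:*_; _:^_; _:=_; con)

-- q^(1+m) / (1 − q^(1+m))
geometric : ℕ → Series
geometric m zero    = 0
geometric m (suc i) = if suc i % suc m ≡ᵇ 0 then 1 else 0

factor≗1+2geometric : ∀ m → factor m ≗ one +ₛ (geometric m +ₛ geometric m)
factor≗1+2geometric m zero = refl
factor≗1+2geometric m (suc i) with suc i % suc m ≡ᵇ 0
... | true  = refl
... | false = refl

8·1≈0 : 8 · one ≈ 0ₛ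
8·1≈0 = coeffwise λ { zero → refl ; (suc n) → refl }

[1+2x]⁴≈1 : ∀ x → (one +ₛ (x +ₛ x)) ^ 4 ≈ one
[1+2x]⁴≈1 x = begin
  (one +ₛ (x +ₛ x)) ^ 4
    ≈⟨ solve 1 (λ x → (con 1 :+ (x :+ x)) :^ 4
                    := con 1 :+ con 8 :* (x :+ con 3 :* x :^ 2 :+ con 4 :* x :^ 3 :+ con 2 :* x :^ 4))
               ≈-refl x ⟩
  one +ₛ 8 · one *ₛ p
    ≈⟨ +-congˡ (≈-trans (*-congʳ 8·1≈0) (zeroˡ p)) ⟩
  one +ₛ 0ₛ
    ≈⟨ +-identityʳ one ⟩
  one ∎
  where
  open import Relation.Binary.Reasoning.Setoid setoid
  p : Series
  p = x +ₛ 3 · one *ₛ x ^ 2 +ₛ 4 · one *ₛ x ^ 3 +ₛ 2 · one *ₛ x ^ 4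

factor⁴≈1 : ∀ m → factor m ^ 4 ≈ one
factor⁴≈1 m = ≈-trans (^-congˡ 4 (≗⇒≈ (factor≗1+2geometric m))) ([1+2x]⁴≈1 (geometric m))

factor⁸≈1 : ∀ m → factor m ^ 8 ≈ one
factor⁸≈1 m = ≈-trans (^-homo-* (factor m) 4 4)
                      (≈-trans (*-cong (factor⁴≈1 m) (factor⁴≈1 m)) (*-identityˡ one))

-- Opaque: unfolding these products during conversion checking is prohibitively slow.
opaque
  G₄ : Series
  G₄ = partialProd 4 3

opaque
  G₈ : Series
  G₈ = partialProd 8 7

-- The numerators of (1 − q^12) G₄ and (1 − q^420) G₈ modulo 8.
Q₄ Q₈ : List ℕ
Q₄ = quotientₚ 13 (1-q^[1+ 11 ] *ₚ numeratorₚ 4 3) (denominatorₚ 4 3)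
Q₈ = quotientₚ 421 (1-q^[1+ 419 ] *ₚ numeratorₚ 8 7) (denominatorₚ 8 7)

opaque
  unfolding G₄

  G₄-recurrence : poly 1-q^[1+ 11 ] *ₛ G₄ ≈ poly Q₄
  -- Deciding the list equality evaluates both sides once; a bare refl is far slower.
  G₄-recurrence = partialProd-recurrence 4 3 11 Q₄ (toWitness {a? = ≡-dec ℕ._≟_ _ _} tt)

  plbar₄≋G₄ : ∀ {n} → 3 ≤ n → plbar 4 n ≋ G₄ n
  plbar₄≋G₄ = plbar≋partialProd 3 factor⁴≈1

opaque
  unfolding G₈

  G₈-recurrence : poly 1-q^[1+ 419 ] *ₛ G₈ ≈ poly Q₈
  G₈-recurrence = partialProd-recurrence 8 7 419 Q₈ (toWitness {a? = ≡-dec ℕ._≟_ _ _} tt)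

  plbar₈≋G₈ : ∀ {n} → 7 ≤ n → plbar 8 n ≋ G₈ n
  plbar₈≋G₈ = plbar≋partialProd 7 factor⁸≈1

module G₄-coeffs = LinearRecurrence 11 G₄ Q₄ G₄-recurrence ℕ.≤-refl
module G₈-coeffs = LinearRecurrence 419 G₈ Q₈ G₈-recurrence ℕ.≤-refl

G₄[12+12n]≋0 : ∀ n → G₄ (12 + 12 * n) ≋ 0
G₄[12+12n]≋0 = G₄-coeffs.vanishes-along 12 12 1 z<s refl
  λ { Fin.zero → trans (G₄-coeffs.coeff-second {0} z≤n) refl }

8∣plbar₄ : ∀ n → G₄ n ≋ 0 → 3 ≤ n → 8 ∣ plbar 4 n
8∣plbar₄ n G₄≋0 3≤n = m%n≡0⇒n∣m _ 8 (trans (plbar₄≋G₄ 3≤n) G₄≋0)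

8∣plbar₈ : ∀ n → G₈ n ≋ 0 → 7 ≤ n → 8 ∣ plbar 8 n
8∣plbar₈ n G₈≋0 7≤n = m%n≡0⇒n∣m _ 8 (trans (plbar₈≋G₈ 7≤n) G₈≋0)

c*[1+n]+r≡c+r+c*n : ∀ c r n → c * suc n + r ≡ (c + r) + c * n
c*[1+n]+r≡c+r+c*n = solve-∀

8∣plbar₄[12n] : ∀ n → 8 ∣ plbar 4 (12 * suc n)
8∣plbar₄[12n] n = subst ((8 ∣_) ∘ plbar 4) (sym (ℕ.*-suc 12 n))
  (8∣plbar₄ (12 + 12 * n) (G₄[12+12n]≋0 n) (ℕ.m≤m+n 3 _))

8∣plbar₄[6n+3] : ∀ n → 8 ∣ plbar 4 (6 * suc n + 3)
8∣plbar₄[6n+3] n = subst ((8 ∣_) ∘ plbar 4) (sym (c*[1+n]+r≡c+r+c*n 6 3 n))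
  (8∣plbar₄ (9 + 6 * n) (G₄-coeffs.vanishes-along-half-period 6 3 refl (ℕ.≤ᵇ⇒≤ _ _ _) refl refl n)
            (ℕ.m≤m+n 3 _))

8∣plbar₈[210n+r] : ∀ r → 210 + r ≤ 419 → poly Q₈ (210 + r) ≋ 0 → poly Q₈ (210 + 210 + r) + poly Q₈ r ≋ 0 →
                   ∀ n → 8 ∣ plbar 8 (210 * suc n + r)
8∣plbar₈[210n+r] r 210+r≤419 Q₈[210+r]≋0 Q₈[420+r]+Q₈[r]≋0 n =
  subst ((8 ∣_) ∘ plbar 8) (sym (c*[1+n]+r≡c+r+c*n 210 r n))
    (8∣plbar₈ (210 + r + 210 * n)
              (G₈-coeffs.vanishes-along-half-period 210 r refl 210+r≤419 Q₈[210+r]≋0 Q₈[420+r]+Q₈[r]≋0 n)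
              (ℕ.m≤m+n 7 _))

theorem1p8 : ∀ (n : ℕ) → n ≥ 1 →
    (8 ∣ plbar 4 (12 * n)) × (8 ∣ plbar 4 (6 * n + 3)) ×
    (8 ∣ plbar 8 (210 * n)) × (8 ∣ plbar 8 (210 * n + 3)) ×
    (8 ∣ plbar 8 (210 * n + 9)) × (8 ∣ plbar 8 (210 * n + 105))
theorem1p8 (suc n) _ =
    8∣plbar₄[12n] n
  , 8∣plbar₄[6n+3] n
  , subst ((8 ∣_) ∘ plbar 8) (ℕ.+-identityʳ (210 * suc n))
      (8∣plbar₈[210n+r] 0 (ℕ.≤ᵇ⇒≤ _ _ _) refl refl n)
  , 8∣plbar₈[210n+r] 3   (ℕ.≤ᵇ⇒≤ _ _ _) refl refl n
  , 8∣plbar₈[210n+r] 9   (ℕ.≤ᵇ⇒≤ _ _ _) refl refl n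
  , 8∣plbar₈[210n+r] 105 (ℕ.≤ᵇ⇒≤ _ _ _) refl refl n
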